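{- Let $\mathcal{R}$ be a rewrite system on terms. In atomic (symmetric) deduction modulo $\mathcal{R}$, every provable sequent has a proof that does not use the Cut rule.
   Context: Fix a first-order language. A rewrite rule is a pair of terms $\langle l, r\rangle$, written $l \rightarrow r$, where $l$ is not a variable; a rewrite system is a set of rewrite rules. The relation $\rightarrow^{1}$ is the smallest relation on terms and on propositions that is compatible with the structure of terms and propositions and such that $\theta l \rightarrow^{1} \theta r$ for every substitution $\theta$ and every rule $l \rightarrow r$. The relation $\equiv$ is the reflexive-symmetric-transitive closure of $\rightarrow^{1}$. Sequents $\Gamma \vdash \Delta$ have finite multisets $\Gamma,\Delta$ of propositions. Atomic (symmetric) deduction modulo $\mathcal{R}$ is the proof system in which all propositions are atomic and whose only rules are: Axiom: $\Gamma, A_1 \vdash A_2, \Delta$ with no premise, provided $A_1 \equiv A_2$; Cut: from $\Gamma \vdash C_1, \Delta$ and $\Gamma, C_2 \vdash \Delta$ infer $\Gamma \vdash \Delta$, provided $C_1 \equiv C_2$; contraction-left: from $\Gamma, A_1, A_2 \vdash \Delta$ infer $\Gamma, A \vdash \Delta$ provided $A_1 \equiv A \equiv A_2$; contraction-right: from $\Gamma \vdash A_1, A_2, \Delta$ infer $\Gamma \vdash A, \Delta$ provided $A_1 \equiv A \equiv A_2$; weakening-left: from $\Gamma \vdash \Delta$ infer $\Gamma, A \vdash \Delta$; weakening-right: from $\Gamma \vdash \Delta$ infer $\Gamma \vdash A, \Delta$. -}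

module Defs where

open import Data.Nat using (ℕ)
open import Data.Fin using (Fin; zero; suc)
open import Data.Vec using (Vec; []; _∷_; lookup; _[_]≔_)
open import Data.List using (List; []; _∷_)
open import Data.Product using (Σ; _×_; _,_)
open import Data.Empty using (⊥)
open import Data.Unit using (⊤)
open import Relation.Binary.PropositionalEquality using (_≡_)
open import Relation.Binary.Construct.Closure.Equivalence using (EqClosure)
open import Data.List.Relation.Binary.Permutation.Propositional using (_↭_)

record Signature : Set₁ where
  field
    Fun    : Set
    arity  : Fun → ℕ
    Pred   : Set
    parity : Pred → ℕ

module Language (S : Signature) where
  open Signature S

  Var : Set
  Var = ℕ

  data Term : Set where
    var : Var → Term
    app : (f : Fun) → Vec Term (arity f) → Term

  -- Atomic propositions (the only propositions of atomic deduction modulo).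
  data Prop : Set where
    atom : (P : Pred) → Vec Term (parity P) → Prop

  Subst : Set
  Subst = Var → Term

  mutual
    subst : Subst → Term → Term
    subst θ (var x)    = θ x
    subst θ (app f ts) = app f (substs θ ts)

    substs : ∀ {n} → Subst → Vec Term n → Vec Term n
    substs θ []       = []
    substs θ (t ∷ ts) = subst θ t ∷ substs θ ts

  IsVar : Term → Set
  IsVar (var _)   = ⊤
  IsVar (app _ _) = ⊥

  record Rule : Set where
    constructor _⟶_∣_
    field
      lhs    : Term
      rhs    : Term
      lhs-nonvar : IsVar lhs → ⊥

  RewriteSystem : Set₁
  RewriteSystem = Rule → Set

  module Modulo (ℛ : RewriteSystem) where

    data _→₁_ : Term → Term → Set where
      root : ∀ (ρ : Rule) → ℛ ρ → (θ : Subst) →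
             subst θ (Rule.lhs ρ) →₁ subst θ (Rule.rhs ρ)
      arg  : ∀ (f : Fun) (ts : Vec Term (arity f)) (i : Fin (arity f)) {u : Term} →
             lookup ts i →₁ u → app f ts →₁ app f (ts [ i ]≔ u)

    data _→₁ᵖ_ : Prop → Prop → Set where
      arg  : ∀ (P : Pred) (ts : Vec Term (parity P)) (i : Fin (parity P)) {u : Term} →
             lookup ts i →₁ u → atom P ts →₁ᵖ atom P (ts [ i ]≔ u)

    _≡ℛ_ : Prop → Prop → Set
    _≡ℛ_ = EqClosure _→₁ᵖ_

    -- Sequents Γ ⊢ Δ: multisets are represented by lists, taken up to
    -- permutation (every rule's conclusion may be any permutation of the
    -- displayed multisets, written Γ′ ↭ A ∷ Γ etc.).
    data _⊢_ : List Prop → List Prop → Set where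
      axiom : ∀ {Γ Δ Γ′ Δ′ A₁ A₂} → A₁ ≡ℛ A₂ →
              Γ′ ↭ (A₁ ∷ Γ) → Δ′ ↭ (A₂ ∷ Δ) → Γ′ ⊢ Δ′
      cut   : ∀ {Γ Δ C₁ C₂} → C₁ ≡ℛ C₂ →
              Γ ⊢ (C₁ ∷ Δ) → (C₂ ∷ Γ) ⊢ Δ → Γ ⊢ Δ
      contrˡ : ∀ {Γ Δ Γ′ A A₁ A₂} → A₁ ≡ℛ A → A ≡ℛ A₂ →
              (A₁ ∷ A₂ ∷ Γ) ⊢ Δ → Γ′ ↭ (A ∷ Γ) → Γ′ ⊢ Δ
      contrʳ : ∀ {Γ Δ Δ′ A A₁ A₂} → A₁ ≡ℛ A → A ≡ℛ A₂ →
              Γ ⊢ (A₁ ∷ A₂ ∷ Δ) → Δ′ ↭ (A ∷ Δ) → Γ ⊢ Δ′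
      weakˡ : ∀ {Γ Δ Γ′ A} → Γ ⊢ Δ → Γ′ ↭ (A ∷ Γ) → Γ′ ⊢ Δ
      weakʳ : ∀ {Γ Δ Δ′ A} → Γ ⊢ Δ → Δ′ ↭ (A ∷ Δ) → Γ ⊢ Δ′

    data CutFree : ∀ {Γ Δ} → Γ ⊢ Δ → Set where
      axiom : ∀ {Γ Δ Γ′ Δ′ A₁ A₂} (e : A₁ ≡ℛ A₂)
              (p : Γ′ ↭ (A₁ ∷ Γ)) (q : Δ′ ↭ (A₂ ∷ Δ)) → CutFree (axiom e p q)
      contrˡ : ∀ {Γ Δ Γ′ A A₁ A₂} (e₁ : A₁ ≡ℛ A) (e₂ : A ≡ℛ A₂)
              {d : (A₁ ∷ A₂ ∷ Γ) ⊢ Δ} (p : Γ′ ↭ (A ∷ Γ)) →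
              CutFree d → CutFree (contrˡ e₁ e₂ d p)
      contrʳ : ∀ {Γ Δ Δ′ A A₁ A₂} (e₁ : A₁ ≡ℛ A) (e₂ : A ≡ℛ A₂)
              {d : Γ ⊢ (A₁ ∷ A₂ ∷ Δ)} (p : Δ′ ↭ (A ∷ Δ)) →
              CutFree d → CutFree (contrʳ e₁ e₂ d p)
      weakˡ : ∀ {Γ Δ Γ′ A} {d : Γ ⊢ Δ} (p : Γ′ ↭ (A ∷ Γ)) →
              CutFree d → CutFree (weakˡ d p)
      weakʳ : ∀ {Γ Δ Δ′ A} {d : Γ ⊢ Δ} (p : Δ′ ↭ (A ∷ Δ)) →
              CutFree d → CutFree (weakʳ d p)

-- Every derivable sequent Γ ⊢ Δ is linked: some A ∈ Γ and B ∈ Δ satisfy A ≡ B.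
-- Axioms are linked by definition, weakening and contraction keep the linking
-- pair up to ≡, and a Cut either inherits a pair avoiding the cut formulas or
-- chains A ≡ C₁ ≡ C₂ ≡ B through them.  A linked sequent is an instance of the
-- Axiom rule, so it has a one-step, cut-free proof.
module Submission where

open import Defs
open import Data.List using (List; _∷_; _++_)
open import Data.List.Membership.Propositional using (_∈_)
open import Data.List.Membership.Propositional.Properties using (∈-∃++)
open import Data.List.Relation.Unary.Any using (here; there)
open import Data.List.Relation.Binary.Subset.Propositional using (_⊆_)
open import Data.List.Relation.Binary.Subset.Propositional.Properties
  using (⊆-reflexive-↭; ⊆-trans; xs⊆x∷xs)
open import Data.List.Relation.Binary.Permutation.Propositional using (_↭_; ↭-sym)
open import Data.List.Relation.Binary.Permutation.Propositional.Properties using (shift)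
open import Data.Product using (Σ; ∃; _×_; _,_)
open import Relation.Binary.PropositionalEquality using (refl)
open import Relation.Binary.Structures using (IsEquivalence)
import Relation.Binary.Construct.Closure.Equivalence as EqClosure

∈⇒↭∷ : ∀ {a} {A : Set a} {x : A} {xs : List A} → x ∈ xs → ∃ λ ys → xs ↭ x ∷ ys
∈⇒↭∷ x∈xs with ys , zs , refl ← ∈-∃++ x∈xs = ys ++ zs , shift _ ys zs

↭∷⇒⊆ : ∀ {a} {A : Set a} {x : A} {xs ys : List A} → ys ↭ x ∷ xs → x ∷ xs ⊆ ys
↭∷⇒⊆ ys↭x∷xs = ⊆-reflexive-↭ (↭-sym ys↭x∷xs)

module CutElimination (S : Signature) (ℛ : Language.RewriteSystem S) where
  open Language S
  open Modulo ℛ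
  open IsEquivalence (EqClosure.isEquivalence _→₁ᵖ_)
    renaming (refl to ≡ℛ-refl; sym to ≡ℛ-sym; trans to ≡ℛ-trans)

  record Linked (Γ Δ : List Prop) : Set where
    constructor linked
    field
      {left right} : Prop
      left∈Γ       : left ∈ Γ
      right∈Δ      : right ∈ Δ
      left≡right   : left ≡ℛ right

  infix 4 _≲_
  _≲_ : List Prop → List Prop → Set
  Γ ≲ Γ′ = ∀ {A} → A ∈ Γ → ∃ λ A′ → A′ ∈ Γ′ × A ≡ℛ A′

  ⊆⇒≲ : ∀ {Γ Γ′} → Γ ⊆ Γ′ → Γ ≲ Γ′
  ⊆⇒≲ Γ⊆Γ′ A∈Γ = _ , Γ⊆Γ′ A∈Γ , ≡ℛ-refl

  contraction-≲ : ∀ {Γ A A₁ A₂} → A₁ ≡ℛ A → A ≡ℛ A₂ → A₁ ∷ A₂ ∷ Γ ≲ A ∷ Γ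
  contraction-≲ e₁ e₂ (here refl)         = _ , here refl , e₁
  contraction-≲ e₁ e₂ (there (here refl)) = _ , here refl , ≡ℛ-sym e₂
  contraction-≲ e₁ e₂ (there (there A∈Γ)) = _ , there A∈Γ , ≡ℛ-refl

  linked-monoˡ : ∀ {Γ Γ′ Δ} → Γ ≲ Γ′ → Linked Γ Δ → Linked Γ′ Δ
  linked-monoˡ Γ≲Γ′ (linked A∈Γ B∈Δ A≡B) with _ , A′∈Γ′ , A≡A′ ← Γ≲Γ′ A∈Γ =
    linked A′∈Γ′ B∈Δ (≡ℛ-trans (≡ℛ-sym A≡A′) A≡B)

  linked-monoʳ : ∀ {Γ Δ Δ′} → Δ ≲ Δ′ → Linked Γ Δ → Linked Γ Δ′
  linked-monoʳ Δ≲Δ′ (linked A∈Γ B∈Δ A≡B) with _ , B′∈Δ′ , B≡B′ ← Δ≲Δ′ B∈Δ =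
    linked A∈Γ B′∈Δ′ (≡ℛ-trans A≡B B≡B′)

  linked-cut : ∀ {Γ Δ C₁ C₂} → C₁ ≡ℛ C₂ →
               Linked Γ (C₁ ∷ Δ) → Linked (C₂ ∷ Γ) Δ → Linked Γ Δ
  linked-cut _ (linked A∈Γ (there B∈Δ) A≡B) _ = linked A∈Γ B∈Δ A≡B
  linked-cut _ _ (linked (there A∈Γ) B∈Δ A≡B) = linked A∈Γ B∈Δ A≡B
  linked-cut C₁≡C₂ (linked A∈Γ (here refl) A≡C₁) (linked (here refl) B∈Δ C₂≡B) =
    linked A∈Γ B∈Δ (≡ℛ-trans A≡C₁ (≡ℛ-trans C₁≡C₂ C₂≡B))

  weakening-≲ : ∀ {Γ Γ′ A} → Γ′ ↭ A ∷ Γ → Γ ≲ Γ′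
  weakening-≲ {Γ} {A = A} p = ⊆⇒≲ (⊆-trans (xs⊆x∷xs Γ A) (↭∷⇒⊆ p))

  ⊢⇒linked : ∀ {Γ Δ} → Γ ⊢ Δ → Linked Γ Δ
  ⊢⇒linked (axiom e p q)      = linked (↭∷⇒⊆ p (here refl)) (↭∷⇒⊆ q (here refl)) e
  ⊢⇒linked (cut e d₁ d₂)      = linked-cut e (⊢⇒linked d₁) (⊢⇒linked d₂)
  ⊢⇒linked (contrˡ e₁ e₂ d p) =
    linked-monoˡ (⊆⇒≲ (↭∷⇒⊆ p)) (linked-monoˡ (contraction-≲ e₁ e₂) (⊢⇒linked d))
  ⊢⇒linked (contrʳ e₁ e₂ d q) =
    linked-monoʳ (⊆⇒≲ (↭∷⇒⊆ q)) (linked-monoʳ (contraction-≲ e₁ e₂) (⊢⇒linked d))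
  ⊢⇒linked (weakˡ d p)        = linked-monoˡ (weakening-≲ p) (⊢⇒linked d)
  ⊢⇒linked (weakʳ d q)        = linked-monoʳ (weakening-≲ q) (⊢⇒linked d)

  linked⇒cut-free : ∀ {Γ Δ} → Linked Γ Δ → Σ (Γ ⊢ Δ) CutFree
  linked⇒cut-free (linked A∈Γ B∈Δ A≡B)
    with _ , p ← ∈⇒↭∷ A∈Γ | _ , q ← ∈⇒↭∷ B∈Δ =
    axiom A≡B p q , axiom A≡B p q

proposition2 : (S : Signature) → let open Language S in (ℛ : RewriteSystem) → let open Modulo ℛ in (Γ Δ : List Prop) → Γ ⊢ Δ → Σ (Γ ⊢ Δ) CutFree
proposition2 S ℛ _ _ d = linked⇒cut-free (⊢⇒linked d)
  where open CutElimination S ℛ
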